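{- Every contractor is a trace function for some irrational number; that is, for every contractor $F$ there is an irrational $\alpha$ such that $|\alpha-r|>|\alpha-F(r)|$ for all $r\in[0,1]\cap\mathbb{Q}$.
   Context: A contractor is a function $F:[0,1]\cap\mathbb{Q}\to\mathbb{Q}$ such that $F(r)\ne r$ for every $r\in[0,1]\cap\mathbb{Q}$ and $|F(r_1)-F(r_2)|<|r_1-r_2|$ for all rationals $r_1\ne r_2$ in $[0,1]$. A trace function for an irrational $\alpha$ is a function $T:[0,1]\cap\mathbb{Q}\to\mathbb{Q}$ with $|\alpha-r|>|\alpha-T(r)|$ for every $r\in[0,1]\cap\mathbb{Q}$. -}

module Defs where

open import Level using (0ℓ)
open import Data.Rational using (ℚ; 0ℚ; 1ℚ; _<_; _≤_; _+_; _-_; ∣_∣)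
open import Data.Product using (Σ; ∃; _×_; proj₁)
open import Data.Sum using (_⊎_)
open import Relation.Nullary using (¬_)
open import Relation.Binary.PropositionalEquality using (_≢_)

UnitQ : Set
UnitQ = Σ ℚ (λ r → 0ℚ ≤ r × r ≤ 1ℚ)

val : UnitQ → ℚ
val = proj₁

record IsContractor (F : UnitQ → ℚ) : Set where
  field
    noFixedPoint : ∀ r → F r ≢ val r
    contracts    : ∀ r₁ r₂ → val r₁ ≢ val r₂ →
                   ∣ F r₁ - F r₂ ∣ < ∣ val r₁ - val r₂ ∣

record ℝ : Set₁ where
  field
    L U        : ℚ → Set
    inhabitedL : ∃ L
    inhabitedU : ∃ U
    roundedL   : ∀ q → L q → ∃ λ r → q < r × L r
    roundedL'  : ∀ q r → q < r → L r → L q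
    roundedU   : ∀ q → U q → ∃ λ r → r < q × U r
    roundedU'  : ∀ q r → q < r → U q → U r
    disjoint   : ∀ q → ¬ (L q × U q)
    located    : ∀ q r → q < r → L q ⊎ U r
open ℝ public

-- The real α equals the rational q  iff  q is neither strictly below
-- nor strictly above α (i.e. neither α < q nor q < α).
EqualsRational : ℝ → ℚ → Set
EqualsRational α q = ¬ L α q × ¬ U α q

Irrational : ℝ → Set
Irrational α = ¬ (∃ λ q → EqualsRational α q)

-- The real number |α - r| (for α real, r rational), given by its cuts:
-- p < |α - r|  iff  p < α - r  or  p < r - α
-- p > |α - r|  iff  p > α - r  and p > r - α
absDiffL : ℝ → ℚ → ℚ → Set
absDiffL α r p = L α (r + p) ⊎ U α (r - p)

absDiffU : ℝ → ℚ → ℚ → Set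
absDiffU α r p = U α (r + p) × L α (r - p)

-- Strict order of reals x < y: some rational lies above x and below y.
-- Here: |α - s| < |α - r|.
_closerTo_than_ : ℝ → ℚ → ℚ → Set
α closerTo s than r = ∃ λ p → absDiffU α s p × absDiffL α r p

IsTraceFunction : (UnitQ → ℚ) → ℝ → Set
IsTraceFunction T α = ∀ r → α closerTo T r than val r

-- Let d(q) = F(q) - q on [0,1]. Since F is contracting, d is strictly decreasing and
-- 2-Lipschitz, and d never vanishes since F has no fixed point. If d(0) < 0, then d < 0
-- throughout, i.e. F(r) < r, while F(r) >= F(0) - 1; so any irrational below F(0) - 1
-- (a shifted square root of 2) is nearer to F(r) than to r. The case d(1) > 0 is symmetric.
-- Otherwise d changes sign on [0,1] and its root alpha is a Dedekind cut, irrational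
-- because d has no rational zero; alpha is the fixed point of the continuous extension
-- of F, so |F(r) - alpha| < |r - alpha|. This inequality is made effective by trapping
-- alpha in rational brackets that are narrow compared with the slack of the contraction.

module Submission where

open import Data.Empty using (⊥-elim)
open import Data.Nat as ℕ using (ℕ; zero; suc)
import Data.Nat.Properties as ℕ
open import Data.Integer as ℤ using (+_; +<+)
import Data.Integer.Properties as ℤ
open import Data.Nat.Coprimality using (Coprime; 1-coprimeTo; recompute) renaming (sym to coprime-sym)
open import Data.Nat.Divisibility using (_∣_; divides)
open import Data.Nat.Primality using (Prime; euclidsLemma; prime⇒nonZero; ¬prime[1]; prime[2])
import Data.Rational.Unnormalised.Base as ℚᵘ
import Data.Rational.Unnormalised.Properties as ℚᵘ
open import Function using (id)
open import Data.Nat.Tactic.RingSolver using (solve-∀)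
open import Data.Rational
open import Data.Rational.Literals using (fromℤ)
open import Data.Rational.Properties
open import Data.Rational.Solver using (module +-*-Solver)
open import Data.Product
open import Data.Sum using (_⊎_; inj₁; inj₂; [_,_]′)
open import Algebra.Bundles using (Ring)
open import Algebra.Properties.Semiring.Mult (Ring.semiring +-*-ring)
  using (×-assoc-*) renaming (_×_ to _·_)
open import Relation.Binary using (Tri; tri<; tri≈; tri>)
open import Relation.Binary.PropositionalEquality
open import Relation.Nullary using (¬_; Dec; yes; no)
open import Defs
open +-*-Solver

-- Rational arithmetic

<⇒≱ : ∀ {p q} → p < q → ¬ (q ≤ p)
<⇒≱ p<q q≤p = <-irrefl refl (<-≤-trans p<q q≤p)

2ℚ : ℚ
2ℚ = fromℤ (+ 2)

0<½ : 0ℚ < ½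
0<½ = positive⁻¹ ½

0≤1 : 0ℚ ≤ 1ℚ
0≤1 = nonNegative⁻¹ 1ℚ

0<* : ∀ {p q} → 0ℚ < p → 0ℚ < q → 0ℚ < p * q
0<* {p} {q} 0<p 0<q = positive⁻¹ (p * q) {{pos*pos⇒pos p {{positive 0<p}} q {{positive 0<q}}}}

0≤* : ∀ {p q} → 0ℚ ≤ p → 0ℚ ≤ q → 0ℚ ≤ p * q
0≤* {p} {q} 0≤p 0≤q = nonNegative⁻¹ (p * q) {{nonNeg*nonNeg⇒nonNeg p {{nonNegative 0≤p}} q {{nonNegative 0≤q}}}}

0≤+ : ∀ {p q} → 0ℚ ≤ p → 0ℚ ≤ q → 0ℚ ≤ p + q
0≤+ = +-mono-≤

0<⊓ : ∀ {p q} → 0ℚ < p → 0ℚ < q → 0ℚ < p ⊓ q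
0<⊓ {p} {q} 0<p 0<q =
  [ (λ p⊓q≡p → subst (0ℚ <_) (sym p⊓q≡p) 0<p) , (λ p⊓q≡q → subst (0ℚ <_) (sym p⊓q≡q) 0<q) ]′ (⊓-sel p q)

p≤∣p∣ : ∀ p → p ≤ ∣ p ∣
p≤∣p∣ p with ≤-total 0ℚ p
... | inj₁ 0≤p = ≤-reflexive (sym (0≤p⇒∣p∣≡p 0≤p))
... | inj₂ p≤0 = ≤-trans p≤0 (0≤∣p∣ p)

∣p-q∣≡∣q-p∣ : ∀ p q → ∣ p - q ∣ ≡ ∣ q - p ∣
∣p-q∣≡∣q-p∣ p q = trans (cong ∣_∣ (solve 2 (λ p q → p :- q := :- (q :- p)) refl p q)) (∣-p∣≡∣p∣ (q - p))

p<q⇒0<q-p : ∀ {p q} → p < q → 0ℚ < q - p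
p<q⇒0<q-p {p} {q} p<q = subst (_< q - p) (+-inverseʳ p) (+-monoˡ-< (- p) p<q)

p≤q⇒0≤q-p : ∀ {p q} → p ≤ q → 0ℚ ≤ q - p
p≤q⇒0≤q-p {p} {q} p≤q = subst (_≤ q - p) (+-inverseʳ p) (+-monoˡ-≤ (- p) p≤q)

0<q-p⇒p<q : ∀ {p q} → 0ℚ < q - p → p < q
0<q-p⇒p<q {p} {q} 0<q-p = subst₂ _<_ (+-identityʳ p) (q+[p-q]≡p) (+-monoʳ-< p 0<q-p)
  where q+[p-q]≡p = solve 2 (λ p q → p :+ (q :- p) := q) refl p q

0≤q-p⇒p≤q : ∀ {p q} → 0ℚ ≤ q - p → p ≤ q
0≤q-p⇒p≤q {p} {q} 0≤q-p = subst₂ _≤_ (+-identityʳ p) (q+[p-q]≡p) (+-monoʳ-≤ p 0≤q-p)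
  where q+[p-q]≡p = solve 2 (λ p q → p :+ (q :- p) := q) refl p q

p≤q⇒p-q≤0 : ∀ {p q} → p ≤ q → p - q ≤ 0ℚ
p≤q⇒p-q≤0 {p} {q} p≤q = subst (p - q ≤_) (+-inverseʳ q) (+-monoˡ-≤ (- q) p≤q)

<-byDifference : ∀ {a b p q} → a < b → b - a ≡ q - p → p < q
<-byDifference a<b eq = 0<q-p⇒p<q (subst (0ℚ <_) eq (p<q⇒0<q-p a<b))

p-q<0⇒p<q : ∀ {p q} → p - q < 0ℚ → p < q
p-q<0⇒p<q {p} {q} p-q<0 = <-byDifference p-q<0 (solve 2 (λ p q → con 0ℚ :- (p :- q) := q :- p) refl p q)

p*½<p : ∀ {p} → 0ℚ < p → p * ½ < p
p*½<p {p} 0<p = <-byDifference (0<* 0<p 0<½) (solve 1 (λ p → p :* con ½ :- con 0ℚ := p :- p :* con ½) refl p)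

≤-byDifference : ∀ {a b p q} → a ≤ b → b - a ≡ q - p → p ≤ q
≤-byDifference a≤b eq = 0≤q-p⇒p≤q (subst (0ℚ ≤_) eq (p≤q⇒0≤q-p a≤b))

p≤q*½⇒2*p≤q : ∀ {p q} → p ≤ q * ½ → 2ℚ * p ≤ q
p≤q*½⇒2*p≤q {p} {q} p≤q*½ =
  ≤-trans (*-monoˡ-≤-nonNeg 2ℚ p≤q*½) (≤-reflexive (solve 1 (λ q → con 2ℚ :* (q :* con ½) := q) refl q))

-- Archimedean property

n·1ℚ≡n : ∀ n → n · 1ℚ ≡ fromℤ (+ n)
n·1ℚ≡n zero    = refl
n·1ℚ≡n (suc n) rewrite n·1ℚ≡n n | ℕ.*-identityʳ n | ℤ.+◃n≡+n n =
  normalize-coprime (coprime-sym (1-coprimeTo (suc n)))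

archimedean-1ℚ : ∀ p → ∃ λ n → p < n · 1ℚ
archimedean-1ℚ p@(mkℚ m d-1 _) = suc ℤ.∣ m ∣ , subst (p <_) (sym (n·1ℚ≡n (suc ℤ.∣ m ∣))) (*<* (begin-strict
  m ℤ.* + 1                      ≡⟨ ℤ.*-identityʳ m ⟩
  m                              ≤⟨ i≤+∣i∣ m ⟩
  + ℤ.∣ m ∣                       <⟨ +<+ (ℕ.<-≤-trans (ℕ.n<1+n _) (ℕ.m≤m*n _ (suc d-1))) ⟩
  + suc ℤ.∣ m ∣ ℤ.* + suc d-1     ∎))
  where
  open ℤ.≤-Reasoning
  i≤+∣i∣ : ∀ i → i ℤ.≤ + ℤ.∣ i ∣
  i≤+∣i∣ (+ _)      = ℤ.≤-refl
  i≤+∣i∣ ℤ.-[1+ _ ] = ℤ.-≤+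

archimedean : ∀ p {δ} → 0ℚ < δ → ∃ λ n → p < n · δ
archimedean p {δ} 0<δ = n , (begin-strict
  p                 ≡⟨ *-identityʳ p ⟨
  p * 1ℚ            ≡⟨ cong (p *_) (*-inverseˡ δ) ⟨
  p * (1/ δ * δ)    ≡⟨ *-assoc p (1/ δ) δ ⟨
  p * 1/ δ * δ      <⟨ *-monoˡ-<-pos δ p/δ<n ⟩
  n · 1ℚ * δ        ≡⟨ ×-assoc-* n 1ℚ δ ⟩
  n · (1ℚ * δ)      ≡⟨ cong (n ·_) (*-identityˡ δ) ⟩
  n · δ             ∎)
  where
  open ≤-Reasoning
  instance
    δ-positive : Positive δ
    δ-positive = positive 0<δ
    δ-nonZero : NonZero δ
    δ-nonZero = pos⇒nonZero δ
  n = proj₁ (archimedean-1ℚ (p * 1/ δ))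
  p/δ<n = proj₂ (archimedean-1ℚ (p * 1/ δ))

-- Dedekind reals

module _ (α : ℝ) where

  lower<upper : ∀ {s t} → L α s → U α t → s < t
  lower<upper {s} {t} s∈L t∈U with <-cmp s t
  ... | tri< s<t _ _  = s<t
  ... | tri≈ _ refl _ = ⊥-elim (disjoint α s (s∈L , t∈U))
  ... | tri> _ _ t<s  = ⊥-elim (disjoint α t (roundedL' α t s t<s s∈L , t∈U))

  closerTo-viaLower : ∀ {s t x r} → L α s → U α t →
                       t - s < x - r → x - s < s - r → α closerTo x than r
  closerTo-viaLower {s} {t} {x} {r} s∈L t∈U t-s<x-r x-s<s-r =
    s - r ,
    (roundedU' α t (x + (s - r))
       (<-byDifference t-s<x-r
         (solve 4 (λ s t x r → (x :- r) :- (t :- s) := (x :+ (s :- r)) :- t) refl s t x r)) t∈U ,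
     roundedL' α (x - (s - r)) s
       (<-byDifference x-s<s-r
         (solve 3 (λ s x r → (s :- r) :- (x :- s) := s :- (x :- (s :- r))) refl s x r)) s∈L) ,
    inj₁ (subst (L α) (solve 2 (λ s r → s := r :+ (s :- r)) refl s r) s∈L)

  closerTo-viaUpper : ∀ {s t x r} → L α s → U α t →
                       t - s < r - x → t - x < r - t → α closerTo x than r
  closerTo-viaUpper {s} {t} {x} {r} s∈L t∈U t-s<r-x t-x<r-t =
    r - t ,
    (roundedU' α t (x + (r - t))
       (<-byDifference t-x<r-t
         (solve 3 (λ t x r → (r :- t) :- (t :- x) := (x :+ (r :- t)) :- t) refl t x r)) t∈U ,
     roundedL' α (x - (r - t)) s
       (<-byDifference t-s<r-x
         (solve 4 (λ s t x r → (r :- x) :- (t :- s) := s :- (x :- (r :- t))) refl s t x r)) s∈L) ,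
    inj₂ (subst (U α) (solve 2 (λ r t → t := r :- (r :- t)) refl r t) t∈U)

  Bracket : ℚ → ℚ → ℚ → Set
  Bracket s₀ t₀ ε = ∃₂ λ s t → L α s × U α t × s₀ ≤ s × t ≤ t₀ × t - s ≤ ε

  bracket : ∀ {s₀ t₀ ε} → L α s₀ → U α t₀ → 0ℚ < ε → Bracket s₀ t₀ ε
  bracket {s₀} {t₀} {ε} s₀∈L t₀∈U 0<ε = scan n s₀ s₀∈L ≤-refl t₀<s₀+n·δ
    where
    -- Walk up from s₀ in steps of δ = ε/2: locatedness at s + δ < s + ε either lets the
    -- walk advance or closes a bracket [s, s + ε]; the Archimedean bound n ends the walk.
    δ = ε * ½
    0<δ : 0ℚ < δ
    0<δ = 0<* 0<ε 0<½
    n = proj₁ (archimedean (t₀ - s₀) 0<δ)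
    t₀<s₀+n·δ : t₀ < s₀ + n · δ
    t₀<s₀+n·δ = <-byDifference (proj₂ (archimedean (t₀ - s₀) 0<δ))
                  (solve 3 (λ s₀ t₀ nδ → nδ :- (t₀ :- s₀) := (s₀ :+ nδ) :- t₀) refl s₀ t₀ (n · δ))
    s+δ<s+ε : ∀ s → s + δ < s + ε
    s+δ<s+ε s = <-byDifference (p*½<p 0<ε)
                  (solve 2 (λ s ε → ε :- ε :* con ½ := (s :+ ε) :- (s :+ ε :* con ½)) refl s ε)
    scan : ∀ n s → L α s → s₀ ≤ s → t₀ < s + n · δ → Bracket s₀ t₀ ε
    scan zero s s∈L _ t₀<s+0 =
      ⊥-elim (<-asym (lower<upper s∈L t₀∈U) (subst (t₀ <_) (+-identityʳ s) t₀<s+0))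
    scan (suc n) s s∈L s₀≤s t₀<s+[1+n]δ = step (located α (s + δ) (s + ε) (s+δ<s+ε s))
      where
      step : L α (s + δ) ⊎ U α (s + ε) → Bracket s₀ t₀ ε
      step (inj₁ s+δ∈L) = scan n (s + δ) s+δ∈L
            (≤-trans s₀≤s (subst (_≤ s + δ) (+-identityʳ s) (+-monoʳ-≤ s (<⇒≤ 0<δ))))
            (subst (t₀ <_) (sym (+-assoc s δ (n · δ))) t₀<s+[1+n]δ)
      step (inj₂ s+ε∈U) = s , t , s∈L , t∈U , s₀≤s , p⊓q≤q (s + ε) t₀ ,
            ≤-byDifference (p⊓q≤p (s + ε) t₀)
              (solve 3 (λ s ε t → (s :+ ε) :- t := ε :- (t :- s)) refl s ε t)
        where
        t = (s + ε) ⊓ t₀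
        t∈U : U α t
        t∈U = [ (λ t≡s+ε → subst (U α) (sym t≡s+ε) s+ε∈U)
              , (λ t≡t₀ → subst (U α) (sym t≡t₀) t₀∈U) ]′ (⊓-sel (s + ε) t₀)

  closerTo-whenBelowBoth : ∀ {u x r} → U α u → u ≤ x → x < r → α closerTo x than r
  closerTo-whenBelowBoth {u} {x} {r} u∈U u≤x x<r =
    let s , t , s∈L , t∈U , _ , t≤u , t-s≤ε =
          bracket (proj₂ (inhabitedL α)) u∈U (0<* (p<q⇒0<q-p x<r) 0<½)
    in closerTo-viaUpper {s} {t} {x} {r} s∈L t∈U
          (≤-<-trans t-s≤ε (p*½<p (p<q⇒0<q-p x<r)))
          (begin-strict
            t - x  ≤⟨ p≤q⇒p-q≤0 (≤-trans t≤u u≤x) ⟩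
            0ℚ     <⟨ p<q⇒0<q-p (≤-<-trans (≤-trans t≤u u≤x) x<r) ⟩
            r - t  ∎)
    where open ≤-Reasoning

  closerTo-whenAboveBoth : ∀ {u x r} → L α u → x ≤ u → r < x → α closerTo x than r
  closerTo-whenAboveBoth {u} {x} {r} u∈L x≤u r<x =
    let s , t , s∈L , t∈U , u≤s , _ , t-s≤ε =
          bracket u∈L (proj₂ (inhabitedU α)) (0<* (p<q⇒0<q-p r<x) 0<½)
    in closerTo-viaLower {s} {t} {x} {r} s∈L t∈U
          (≤-<-trans t-s≤ε (p*½<p (p<q⇒0<q-p r<x)))
          (begin-strict
            x - s  ≤⟨ p≤q⇒p-q≤0 (≤-trans x≤u u≤s) ⟩
            0ℚ     <⟨ p<q⇒0<q-p (<-≤-trans r<x (≤-trans x≤u u≤s)) ⟩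
            s - r  ∎)
    where open ≤-Reasoning

-- Square roots of primes are irrational

prime∣square⇒prime∣ : ∀ {p m} → Prime p → p ∣ m ℕ.* m → p ∣ m
prime∣square⇒prime∣ {m = m} p-prime p∣m² = [ id , id ]′ (euclidsLemma m m p-prime p∣m²)

square≢prime*square : ∀ {p m n} → Prime p → Coprime m n → m ℕ.* m ≢ p ℕ.* (n ℕ.* n)
square≢prime*square {p} {m} {n} p-prime m⊥n m²≡pn²
  with prime∣square⇒prime∣ {m = m} p-prime (divides (n ℕ.* n) (trans m²≡pn² (ℕ.*-comm p (n ℕ.* n))))
... | divides k refl = ¬prime[1] (subst Prime (m⊥n (divides k refl , p∣n)) p-prime)
  where
  instance
    p-nonZero : ℕ.NonZero p
    p-nonZero = prime⇒nonZero p-prime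
  n²≡k²p : n ℕ.* n ≡ k ℕ.* k ℕ.* p
  n²≡k²p = ℕ.*-cancelˡ-≡ (n ℕ.* n) (k ℕ.* k ℕ.* p) p (trans (sym m²≡pn²) (kp*kp≡p*kkp k p))
    where
    kp*kp≡p*kkp : ∀ k p → k ℕ.* p ℕ.* (k ℕ.* p) ≡ p ℕ.* (k ℕ.* k ℕ.* p)
    kp*kp≡p*kkp = solve-∀
  p∣n : p ∣ n
  p∣n = prime∣square⇒prime∣ p-prime (divides (k ℕ.* k) n²≡k²p)

q*q≢prime : ∀ {p} → Prime p → ∀ q → q * q ≢ fromℤ (+ p)
q*q≢prime {p} p-prime q@(mkℚ m d-1 m⊥d) q²≡p
  with ℚᵘ.≃-trans (ℚᵘ.≃-sym (toℚᵘ-homo-* q q)) (toℚᵘ-cong q²≡p)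
... | ℚᵘ.*≡* eq = square≢prime*square p-prime (recompute m⊥d) (begin
  ℤ.∣ m ∣ ℕ.* ℤ.∣ m ∣                    ≡⟨ ℤ.abs-* m m ⟨
  ℤ.∣ m ℤ.* m ∣                          ≡⟨ ℕ.*-identityʳ _ ⟨
  ℤ.∣ m ℤ.* m ∣ ℕ.* 1                    ≡⟨ ℤ.abs-* (m ℤ.* m) (+ 1) ⟨
  ℤ.∣ m ℤ.* m ℤ.* + 1 ∣                  ≡⟨ cong ℤ.∣_∣ eq ⟩
  ℤ.∣ + p ℤ.* + (suc d-1 ℕ.* suc d-1) ∣  ≡⟨ ℤ.abs-* (+ p) _ ⟩
  p ℕ.* (suc d-1 ℕ.* suc d-1)            ∎)
  where open ≡-Reasoning

-- The root of a function changing sign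

module SignChangeCut {a b : ℚ} (H : ℚ → ℚ) (K : ℚ) (0<K : 0ℚ < K) (a<b : a < b)
  (0<H[a] : 0ℚ < H a) (H[b]<0 : H b < 0ℚ)
  (H≢0 : ∀ {q} → a ≤ q → q ≤ b → H q ≢ 0ℚ)
  (antitone : ∀ {x y} → a ≤ x → x ≤ y → y ≤ b → H y ≤ H x)
  (lipschitz : ∀ {x y} → a ≤ x → x ≤ y → y ≤ b → H x ≤ H y + K * (y - x))
  where

  private instance
    K-positive : Positive K
    K-positive = positive 0<K
    K-nonNegative : NonNegative K
    K-nonNegative = pos⇒nonNeg K
    K-nonZero : NonZero K
    K-nonZero = pos⇒nonZero K

  K*[p*1/K]≡p : ∀ p → K * (p * 1/ K) ≡ p
  K*[p*1/K]≡p p = begin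
    K * (p * 1/ K)  ≡⟨ solve 3 (λ K p w → K :* (p :* w) := p :* (K :* w)) refl K p (1/ K) ⟩
    p * (K * 1/ K)  ≡⟨ cong (p *_) (*-inverseʳ K) ⟩
    p * 1ℚ          ≡⟨ *-identityʳ p ⟩
    p               ∎
    where open ≡-Reasoning

  0<p*½*1/K : ∀ {p} → 0ℚ < p → 0ℚ < p * ½ * 1/ K
  0<p*½*1/K 0<p = 0<* (0<* 0<p 0<½) (positive⁻¹ (1/ K) {{1/pos⇒pos K}})

  positive-persists : ∀ {x} → a ≤ x → x ≤ b → 0ℚ < H x → ∃ λ y → x < y × y ≤ b × 0ℚ < H y
  positive-persists {x} a≤x x≤b 0<H[x] = x + h , x<x+h , x+h≤b , 0<H[x+h]
    where
    c = H x * ½ * 1/ K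
    h = (b - x) ⊓ c
    x<b : x < b
    x<b = ≰⇒> λ b≤x → <-asym 0<H[x] (≤-<-trans (antitone (<⇒≤ a<b) b≤x x≤b) H[b]<0)
    x<x+h : x < x + h
    x<x+h = <-byDifference (0<⊓ (p<q⇒0<q-p x<b) (0<p*½*1/K 0<H[x]))
              (solve 2 (λ x h → h :- con 0ℚ := (x :+ h) :- x) refl x h)
    x+h≤b : x + h ≤ b
    x+h≤b = ≤-byDifference (p⊓q≤p (b - x) c)
              (solve 3 (λ x h b → (b :- x) :- h := b :- (x :+ h)) refl x h b)
    0<H[x+h] : 0ℚ < H (x + h)
    0<H[x+h] = begin-strict
      0ℚ                       <⟨ 0<* 0<H[x] 0<½ ⟩
      H x * ½                  ≡⟨ solve 1 (λ y → y :* con ½ := y :- y :* con ½) refl (H x) ⟩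
      H x - H x * ½            ≡⟨ cong (λ z → H x - z) (K*[p*1/K]≡p (H x * ½)) ⟨
      H x - K * c              ≤⟨ +-monoʳ-≤ (H x) (neg-antimono-≤ (*-monoˡ-≤-nonNeg K (p⊓q≤q (b - x) c))) ⟩
      H x - K * h              ≡⟨ cong (λ z → H x - K * z) (solve 2 (λ x h → h := (x :+ h) :- x) refl x h) ⟩
      H x - K * (x + h - x)    ≤⟨ ≤-byDifference (lipschitz a≤x (<⇒≤ x<x+h) x+h≤b)
                                    (solve 3 (λ y z w → (z :+ w) :- y := z :- (y :- w)) refl
                                       (H x) (H (x + h)) (K * (x + h - x))) ⟩
      H (x + h)                ∎
      where open ≤-Reasoning

  negative-persists : ∀ {x} → a ≤ x → x ≤ b → H x < 0ℚ → ∃ λ y → a ≤ y × y < x × H y < 0ℚ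
  negative-persists {x} a≤x x≤b H[x]<0 = x - h , a≤x-h , x-h<x , H[x-h]<0
    where
    c = (- H x) * ½ * 1/ K
    h = (x - a) ⊓ c
    a<x : a < x
    a<x = ≰⇒> λ x≤a → <-asym H[x]<0 (<-≤-trans 0<H[a] (antitone a≤x x≤a (<⇒≤ a<b)))
    0<-H[x] : 0ℚ < - H x
    0<-H[x] = neg-antimono-< H[x]<0
    x-h<x : x - h < x
    x-h<x = <-byDifference (0<⊓ (p<q⇒0<q-p a<x) (0<p*½*1/K 0<-H[x]))
              (solve 2 (λ x h → h :- con 0ℚ := x :- (x :- h)) refl x h)
    a≤x-h : a ≤ x - h
    a≤x-h = ≤-byDifference (p⊓q≤p (x - a) c)
              (solve 3 (λ x h a → (x :- a) :- h := (x :- h) :- a) refl x h a)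
    H[x-h]<0 : H (x - h) < 0ℚ
    H[x-h]<0 = begin-strict
      H (x - h)                  ≤⟨ lipschitz a≤x-h (<⇒≤ x-h<x) x≤b ⟩
      H x + K * (x - (x - h))    ≡⟨ cong (λ z → H x + K * z) (solve 2 (λ x h → x :- (x :- h) := h) refl x h) ⟩
      H x + K * h                ≤⟨ +-monoʳ-≤ (H x) (*-monoˡ-≤-nonNeg K (p⊓q≤q (x - a) c)) ⟩
      H x + K * c                ≡⟨ cong (λ z → H x + z) (K*[p*1/K]≡p (- H x * ½)) ⟩
      H x + - H x * ½            ≡⟨ solve 1 (λ y → y :+ (:- y) :* con ½ := :- ((:- y) :* con ½)) refl (H x) ⟩
      - (- H x * ½)              <⟨ neg-antimono-< (0<* 0<-H[x] 0<½) ⟩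
      0ℚ                         ∎
      where open ≤-Reasoning

  Lower Upper : ℚ → Set
  Lower q = q < a ⊎ (a ≤ q × q ≤ b × 0ℚ < H q)
  Upper q = b < q ⊎ (a ≤ q × q ≤ b × H q < 0ℚ)

  a∈Lower : Lower a
  a∈Lower = inj₂ (≤-refl , <⇒≤ a<b , 0<H[a])

  b∈Upper : Upper b
  b∈Upper = inj₂ (<⇒≤ a<b , ≤-refl , H[b]<0)

  lower-rounded : ∀ q → Lower q → ∃ λ r → q < r × Lower r
  lower-rounded q (inj₁ q<a)               = a , q<a , a∈Lower
  lower-rounded q (inj₂ (a≤q , q≤b , 0<H[q])) =
    let r , q<r , r≤b , 0<H[r] = positive-persists a≤q q≤b 0<H[q]
    in r , q<r , inj₂ (≤-trans a≤q (<⇒≤ q<r) , r≤b , 0<H[r])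

  upper-rounded : ∀ q → Upper q → ∃ λ r → r < q × Upper r
  upper-rounded q (inj₁ b<q)               = b , b<q , b∈Upper
  upper-rounded q (inj₂ (a≤q , q≤b , H[q]<0)) =
    let r , a≤r , r<q , H[r]<0 = negative-persists a≤q q≤b H[q]<0
    in r , r<q , inj₂ (a≤r , ≤-trans (<⇒≤ r<q) q≤b , H[r]<0)

  lower-downClosed : ∀ q r → q < r → Lower r → Lower q
  lower-downClosed q r q<r (inj₁ r<a) = inj₁ (<-trans q<r r<a)
  lower-downClosed q r q<r (inj₂ (a≤r , r≤b , 0<H[r])) = decide (q <? a)
    where
    decide : Dec (q < a) → Lower q
    decide (yes q<a) = inj₁ q<a
    decide (no q≮a)  =
      inj₂ (≮⇒≥ q≮a , ≤-trans (<⇒≤ q<r) r≤b , <-≤-trans 0<H[r] (antitone (≮⇒≥ q≮a) (<⇒≤ q<r) r≤b))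

  upper-upClosed : ∀ q r → q < r → Upper q → Upper r
  upper-upClosed q r q<r (inj₁ b<q) = inj₁ (<-trans b<q q<r)
  upper-upClosed q r q<r (inj₂ (a≤q , q≤b , H[q]<0)) = decide (b <? r)
    where
    decide : Dec (b < r) → Upper r
    decide (yes b<r) = inj₁ b<r
    decide (no b≮r)  =
      inj₂ (≤-trans a≤q (<⇒≤ q<r) , ≮⇒≥ b≮r , ≤-<-trans (antitone a≤q (<⇒≤ q<r) (≮⇒≥ b≮r)) H[q]<0)

  lower-upper-disjoint : ∀ q → ¬ (Lower q × Upper q)
  lower-upper-disjoint q (inj₁ q<a , inj₁ b<q)                 = <-asym (<-trans q<a a<b) b<q
  lower-upper-disjoint q (inj₁ q<a , inj₂ (a≤q , _))          = <⇒≱ q<a a≤q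
  lower-upper-disjoint q (inj₂ (_ , q≤b , _) , inj₁ b<q)      = <⇒≱ b<q q≤b
  lower-upper-disjoint q (inj₂ (_ , _ , 0<H[q]) , inj₂ (_ , _ , H[q]<0)) = <-asym 0<H[q] H[q]<0

  lower-or-upper : ∀ q → Lower q ⊎ Upper q
  lower-or-upper q = decide (q <? a) (b <? q)
    where
    decide : Dec (q < a) → Dec (b < q) → Lower q ⊎ Upper q
    decide (yes q<a) _         = inj₁ (inj₁ q<a)
    decide (no _)    (yes b<q) = inj₂ (inj₁ b<q)
    decide (no q≮a)  (no b≮q)  with <-cmp 0ℚ (H q)
    ... | tri< 0<H[q] _ _   = inj₁ (inj₂ (≮⇒≥ q≮a , ≮⇒≥ b≮q , 0<H[q]))
    ... | tri≈ _ 0≡H[q] _   = ⊥-elim (H≢0 (≮⇒≥ q≮a) (≮⇒≥ b≮q) (sym 0≡H[q]))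
    ... | tri> _ _ H[q]<0   = inj₂ (inj₂ (≮⇒≥ q≮a , ≮⇒≥ b≮q , H[q]<0))

  root : ℝ
  root = record
    { L = Lower ; U = Upper
    ; inhabitedL = a , a∈Lower ; inhabitedU = b , b∈Upper
    ; roundedL = lower-rounded ; roundedL' = lower-downClosed
    ; roundedU = upper-rounded ; roundedU' = upper-upClosed
    ; disjoint = lower-upper-disjoint
    ; located = λ q r q<r → [ inj₁ , (λ q∈U → inj₂ (upper-upClosed q r q<r q∈U)) ]′ (lower-or-upper q)
    }

  root-irrational : Irrational root
  root-irrational (q , q∉L , q∉U) = [ q∉L , q∉U ]′ (lower-or-upper q)

  lower⇒positive : ∀ {q} → a ≤ q → Lower q → q ≤ b × 0ℚ < H q
  lower⇒positive a≤q (inj₁ q<a)              = ⊥-elim (<⇒≱ q<a a≤q)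
  lower⇒positive _   (inj₂ (_ , q≤b , 0<H[q])) = q≤b , 0<H[q]

  upper⇒negative : ∀ {q} → q ≤ b → Upper q → a ≤ q × H q < 0ℚ
  upper⇒negative q≤b (inj₁ b<q)              = ⊥-elim (<⇒≱ b<q q≤b)
  upper⇒negative _   (inj₂ (a≤q , _ , H[q]<0)) = a≤q , H[q]<0

  H[s]<K*[t-s] : ∀ {s t} → a ≤ s → t ≤ b → Lower s → Upper t → H s < K * (t - s)
  H[s]<K*[t-s] {s} {t} a≤s t≤b s∈L t∈U = begin-strict
    H s                 ≤⟨ lipschitz a≤s (<⇒≤ (lower<upper root s∈L t∈U)) t≤b ⟩
    H t + K * (t - s)   <⟨ +-monoˡ-< (K * (t - s)) (proj₂ (upper⇒negative t≤b t∈U)) ⟩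
    0ℚ + K * (t - s)    ≡⟨ +-identityˡ (K * (t - s)) ⟩
    K * (t - s)         ∎
    where open ≤-Reasoning

  -H[t]<K*[t-s] : ∀ {s t} → a ≤ s → t ≤ b → Lower s → Upper t → - H t < K * (t - s)
  -H[t]<K*[t-s] {s} {t} a≤s t≤b s∈L t∈U = begin-strict
    - H t               ≡⟨ +-identityˡ (- H t) ⟨
    0ℚ - H t            <⟨ +-monoˡ-< (- H t) (proj₂ (lower⇒positive a≤s s∈L)) ⟩
    H s - H t           ≤⟨ ≤-byDifference (lipschitz a≤s (<⇒≤ (lower<upper root s∈L t∈U)) t≤b)
                             (solve 3 (λ x y w → (y :+ w) :- x := w :- (x :- y)) refl
                                (H s) (H t) (K * (t - s))) ⟩
    K * (t - s)         ∎
    where open ≤-Reasoning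

irrational-between : ∀ c → Σ ℝ λ α → Irrational α × L α c × U α (c + 1ℚ)
irrational-between c = root , root-irrational , a∈Lower , b∈Upper
  where
  4ℚ = fromℤ (+ 4)

  -- The root of H is c - 1 + √2, which lies strictly between c and c + 1.
  H : ℚ → ℚ
  H q = 2ℚ - (q - c + 1ℚ) * (q - c + 1ℚ)

  c<c+1 : c < c + 1ℚ
  c<c+1 = <-byDifference (positive⁻¹ 1ℚ) (solve 1 (λ c → con 1ℚ :- con 0ℚ := (c :+ con 1ℚ) :- c) refl c)

  0<H[c] : 0ℚ < H c
  0<H[c] = subst (0ℚ <_) (solve 1 (λ c → con 1ℚ := con 2ℚ :- (c :- c :+ con 1ℚ) :* (c :- c :+ con 1ℚ)) refl c)
             (positive⁻¹ 1ℚ)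

  H[c+1]<0 : H (c + 1ℚ) < 0ℚ
  H[c+1]<0 = subst (_< 0ℚ)
    (solve 1 (λ c → :- con 2ℚ := con 2ℚ :- (c :+ con 1ℚ :- c :+ con 1ℚ) :* (c :+ con 1ℚ :- c :+ con 1ℚ)) refl c)
    (neg-antimono-< (positive⁻¹ 2ℚ))

  H≢0 : ∀ {q} → c ≤ q → q ≤ c + 1ℚ → H q ≢ 0ℚ
  H≢0 {q} _ _ H[q]≡0 = q*q≢prime prime[2] (q - c + 1ℚ) (begin
    (q - c + 1ℚ) * (q - c + 1ℚ)  ≡⟨ solve 2 (λ w z → w := z :- (z :- w)) refl
                                      ((q - c + 1ℚ) * (q - c + 1ℚ)) 2ℚ ⟩
    2ℚ - H q                      ≡⟨ cong (λ z → 2ℚ - z) H[q]≡0 ⟩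
    2ℚ - 0ℚ                       ≡⟨ +-identityʳ 2ℚ ⟩
    2ℚ                            ∎)
    where open ≡-Reasoning

  antitone : ∀ {x y} → c ≤ x → x ≤ y → y ≤ c + 1ℚ → H y ≤ H x
  antitone {x} {y} c≤x x≤y _ = ≤-byDifference
    (0≤* (p≤q⇒0≤q-p x≤y) (0≤+ (0≤+ (p≤q⇒0≤q-p c≤x) 0≤1) (0≤+ (p≤q⇒0≤q-p (≤-trans c≤x x≤y)) 0≤1)))
    (solve 3 (λ x y c → (y :- x) :* ((x :- c :+ con 1ℚ) :+ (y :- c :+ con 1ℚ)) :- con 0ℚ
                      := (con 2ℚ :- (x :- c :+ con 1ℚ) :* (x :- c :+ con 1ℚ))
                         :- (con 2ℚ :- (y :- c :+ con 1ℚ) :* (y :- c :+ con 1ℚ))) refl x y c)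

  lipschitz : ∀ {x y} → c ≤ x → x ≤ y → y ≤ c + 1ℚ → H x ≤ H y + 4ℚ * (y - x)
  lipschitz {x} {y} _ x≤y y≤c+1 = ≤-byDifference
    (0≤* (p≤q⇒0≤q-p x≤y) (0≤+ (p≤q⇒0≤q-p (≤-trans x≤y y≤c+1)) (p≤q⇒0≤q-p y≤c+1)))
    (solve 3 (λ x y c → (y :- x) :* ((c :+ con 1ℚ :- x) :+ (c :+ con 1ℚ :- y)) :- con 0ℚ
                      := ((con 2ℚ :- (y :- c :+ con 1ℚ) :* (y :- c :+ con 1ℚ)) :+ con 4ℚ :* (y :- x))
                         :- (con 2ℚ :- (x :- c :+ con 1ℚ) :* (x :- c :+ con 1ℚ))) refl x y c)

  open SignChangeCut H 4ℚ (positive⁻¹ 4ℚ) c<c+1 0<H[c] H[c+1]<0 H≢0 antitone lipschitz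

-- Contractors

val-injective : ∀ {r r′ : UnitQ} → val r ≡ val r′ → r ≡ r′
val-injective {q , _} {.q , _} refl = cong (q ,_) (cong₂ _,_ (≤-irrelevant _ _) (≤-irrelevant _ _))

0≤val : ∀ r → 0ℚ ≤ val r
0≤val r = proj₁ (proj₂ r)

val≤1 : ∀ r → val r ≤ 1ℚ
val≤1 r = proj₂ (proj₂ r)

clamp : ℚ → UnitQ
clamp q = (0ℚ ⊔ q) ⊓ 1ℚ , ⊓-glb (p≤p⊔q 0ℚ q) 0≤1 , p⊓q≤q (0ℚ ⊔ q) 1ℚ

val∘clamp : ∀ {q} → 0ℚ ≤ q → q ≤ 1ℚ → val (clamp q) ≡ q
val∘clamp 0≤q q≤1 = trans (cong (_⊓ 1ℚ) (p≤q⇒p⊔q≡q 0≤q)) (p≤q⇒p⊓q≡p q≤1)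

module Contractor (F : UnitQ → ℚ) (F-contractor : IsContractor F) where
  open IsContractor F-contractor

  F̂ : ℚ → ℚ
  F̂ q = F (clamp q)

  F̂∘val : ∀ r → F̂ (val r) ≡ F r
  F̂∘val r = cong F (val-injective (val∘clamp (0≤val r) (val≤1 r)))

  F̂-contracting : ∀ {x y} → 0ℚ ≤ x → x < y → y ≤ 1ℚ → ∣ F̂ x - F̂ y ∣ < y - x
  F̂-contracting {x} {y} 0≤x x<y y≤1 = begin-strict
    ∣ F̂ x - F̂ y ∣                      <⟨ contracts (clamp x) (clamp y) x̂≢ŷ ⟩
    ∣ val (clamp x) - val (clamp y) ∣  ≡⟨ cong₂ (λ u v → ∣ u - v ∣) x̂≡x ŷ≡y ⟩
    ∣ x - y ∣                          ≡⟨ ∣p-q∣≡∣q-p∣ x y ⟩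
    ∣ y - x ∣                          ≡⟨ 0≤p⇒∣p∣≡p (p≤q⇒0≤q-p (<⇒≤ x<y)) ⟩
    y - x                              ∎
    where
    open ≤-Reasoning
    x̂≡x = val∘clamp 0≤x (≤-trans (<⇒≤ x<y) y≤1)
    ŷ≡y = val∘clamp (≤-trans 0≤x (<⇒≤ x<y)) y≤1
    x̂≢ŷ : val (clamp x) ≢ val (clamp y)
    x̂≢ŷ x̂≡ŷ = <⇒≢ x<y (trans (sym x̂≡x) (trans x̂≡ŷ ŷ≡y))

  F̂-nonexpanding : ∀ {x y} → 0ℚ ≤ x → x ≤ y → y ≤ 1ℚ → ∣ F̂ x - F̂ y ∣ ≤ y - x
  F̂-nonexpanding {x} {y} 0≤x x≤y y≤1 = byCases (<-cmp x y)
    where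
    byCases : Tri (x < y) (x ≡ y) (y < x) → ∣ F̂ x - F̂ y ∣ ≤ y - x
    byCases (tri< x<y _ _)  = <⇒≤ (F̂-contracting 0≤x x<y y≤1)
    byCases (tri≈ _ refl _) = ≤-reflexive (trans (cong ∣_∣ (+-inverseʳ (F̂ x))) (sym (+-inverseʳ x)))
    byCases (tri> _ _ y<x)  = ⊥-elim (<⇒≱ y<x x≤y)

  F̂-drop≤ : ∀ {x y} → 0ℚ ≤ x → x ≤ y → y ≤ 1ℚ → F̂ x - F̂ y ≤ y - x
  F̂-drop≤ 0≤x x≤y y≤1 = ≤-trans (p≤∣p∣ _) (F̂-nonexpanding 0≤x x≤y y≤1)

  F̂-rise≤ : ∀ {x y} → 0ℚ ≤ x → x ≤ y → y ≤ 1ℚ → F̂ y - F̂ x ≤ y - x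
  F̂-rise≤ {x} {y} 0≤x x≤y y≤1 =
    ≤-trans (p≤∣p∣ _) (subst (_≤ y - x) (∣p-q∣≡∣q-p∣ (F̂ x) (F̂ y)) (F̂-nonexpanding 0≤x x≤y y≤1))

  displacement : ℚ → ℚ
  displacement q = F̂ q - q

  displacement≢0 : ∀ {q} → 0ℚ ≤ q → q ≤ 1ℚ → displacement q ≢ 0ℚ
  displacement≢0 {q} 0≤q q≤1 F̂q-q≡0 = noFixedPoint (clamp q) (begin
    F̂ q               ≡⟨ solve 2 (λ y q → y := (y :- q) :+ q) refl (F̂ q) q ⟩
    (F̂ q - q) + q     ≡⟨ cong (_+ q) F̂q-q≡0 ⟩
    0ℚ + q            ≡⟨ +-identityˡ q ⟩
    q                 ≡⟨ val∘clamp 0≤q q≤1 ⟨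
    val (clamp q)     ∎)
    where open ≡-Reasoning

  displacement-antitone : ∀ {x y} → 0ℚ ≤ x → x ≤ y → y ≤ 1ℚ → displacement y ≤ displacement x
  displacement-antitone {x} {y} 0≤x x≤y y≤1 = ≤-byDifference (F̂-rise≤ 0≤x x≤y y≤1)
    (solve 4 (λ x y u v → (y :- x) :- (v :- u) := (u :- x) :- (v :- y)) refl x y (F̂ x) (F̂ y))

  displacement-lipschitz : ∀ {x y} → 0ℚ ≤ x → x ≤ y → y ≤ 1ℚ →
                           displacement x ≤ displacement y + 2ℚ * (y - x)
  displacement-lipschitz {x} {y} 0≤x x≤y y≤1 = ≤-byDifference (F̂-drop≤ 0≤x x≤y y≤1)
    (solve 4 (λ x y u v → (y :- x) :- (u :- v) := ((v :- y) :+ con 2ℚ :* (y :- x)) :- (u :- x))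
       refl x y (F̂ x) (F̂ y))

  F-lowerBound : ∀ r → F̂ 0ℚ - 1ℚ ≤ F r
  F-lowerBound r = subst (F̂ 0ℚ - 1ℚ ≤_) (F̂∘val r) (≤-byDifference F̂0-F̂r≤1
    (solve 2 (λ u v → con 1ℚ :- (u :- v) := v :- (u :- con 1ℚ)) refl (F̂ 0ℚ) (F̂ (val r))))
    where
    open ≤-Reasoning
    F̂0-F̂r≤1 : F̂ 0ℚ - F̂ (val r) ≤ 1ℚ
    F̂0-F̂r≤1 = begin
      F̂ 0ℚ - F̂ (val r)  ≤⟨ F̂-drop≤ ≤-refl (0≤val r) (val≤1 r) ⟩
      val r - 0ℚ        ≡⟨ +-identityʳ (val r) ⟩
      val r             ≤⟨ val≤1 r ⟩
      1ℚ                ∎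

  F-upperBound : ∀ r → F r ≤ F̂ 1ℚ + 1ℚ
  F-upperBound r = subst (_≤ F̂ 1ℚ + 1ℚ) (F̂∘val r) (≤-byDifference F̂r-F̂1≤1
    (solve 2 (λ u v → con 1ℚ :- (v :- u) := (u :+ con 1ℚ) :- v) refl (F̂ 1ℚ) (F̂ (val r))))
    where
    open ≤-Reasoning
    F̂r-F̂1≤1 : F̂ (val r) - F̂ 1ℚ ≤ 1ℚ
    F̂r-F̂1≤1 = begin
      F̂ (val r) - F̂ 1ℚ  ≤⟨ F̂-drop≤ (0≤val r) (val≤1 r) ≤-refl ⟩
      1ℚ - val r        ≤⟨ +-monoʳ-≤ 1ℚ (neg-antimono-≤ (0≤val r)) ⟩
      1ℚ                ∎

  F<id : displacement 0ℚ < 0ℚ → ∀ r → F r < val r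
  F<id d[0]<0 r = subst (_< val r) (F̂∘val r)
    (p-q<0⇒p<q (≤-<-trans (displacement-antitone ≤-refl (0≤val r) (val≤1 r)) d[0]<0))

  id<F : 0ℚ < displacement 1ℚ → ∀ r → val r < F r
  id<F 0<d[1] r = subst (val r <_) (F̂∘val r)
    (0<q-p⇒p<q (<-≤-trans 0<d[1] (displacement-antitone (0≤val r) (val≤1 r) ≤-refl)))

  trace-belowDiagonal : displacement 0ℚ < 0ℚ → Σ ℝ λ α → Irrational α × IsTraceFunction F α
  trace-belowDiagonal d[0]<0 =
    let α , α-irrational , _ , c+1∈U = irrational-between (F̂ 0ℚ - 2ℚ)
    in α , α-irrational , λ r →
         closerTo-whenBelowBoth α c+1∈U (≤-trans (≤-reflexive c+1≡F̂0-1) (F-lowerBound r)) (F<id d[0]<0 r)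
    where
    c+1≡F̂0-1 : F̂ 0ℚ - 2ℚ + 1ℚ ≡ F̂ 0ℚ - 1ℚ
    c+1≡F̂0-1 = solve 1 (λ u → u :- con 2ℚ :+ con 1ℚ := u :- con 1ℚ) refl (F̂ 0ℚ)

  trace-aboveDiagonal : 0ℚ < displacement 1ℚ → Σ ℝ λ α → Irrational α × IsTraceFunction F α
  trace-aboveDiagonal 0<d[1] =
    let α , α-irrational , c∈L , _ = irrational-between (F̂ 1ℚ + 1ℚ)
    in α , α-irrational , λ r → closerTo-whenAboveBoth α c∈L (F-upperBound r) (id<F 0<d[1] r)

  module FixedPoint (0<d[0] : 0ℚ < displacement 0ℚ) (d[1]<0 : displacement 1ℚ < 0ℚ) where
    open SignChangeCut displacement 2ℚ (positive⁻¹ 2ℚ) (positive⁻¹ 1ℚ) 0<d[0] d[1]<0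
                       displacement≢0 displacement-antitone displacement-lipschitz

    -- g is the slack in the contraction inequality between r and the anchor s₀; once the
    -- bracket of the root is narrower than both g/2 and d(r)/2, F̂ r beats r.
    closerTo-belowRoot : ∀ {r} → 0ℚ ≤ r → r ≤ 1ℚ → 0ℚ < displacement r → root closerTo F̂ r than r
    closerTo-belowRoot {r} 0≤r r≤1 0<d[r] = fromAnchor (lower-rounded r (inj₂ (0≤r , r≤1 , 0<d[r])))
      where
      fromAnchor : (∃ λ s₀ → r < s₀ × Lower s₀) → root closerTo F̂ r than r
      fromAnchor (s₀ , r<s₀ , s₀∈L) = fromBracket (bracket root s₀∈L b∈Upper (0<* 0<m 0<½))
        where
        0≤s₀ = ≤-trans 0≤r (<⇒≤ r<s₀)
        s₀≤1 = proj₁ (lower⇒positive 0≤s₀ s₀∈L)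
        g = (s₀ - r) - (F̂ r - F̂ s₀)
        0<g : 0ℚ < g
        0<g = p<q⇒0<q-p (≤-<-trans (p≤∣p∣ _) (F̂-contracting 0≤r r<s₀ s₀≤1))
        m = g ⊓ displacement r
        0<m = 0<⊓ 0<g 0<d[r]
        fromBracket : Bracket root s₀ 1ℚ (m * ½) → root closerTo F̂ r than r
        fromBracket (s , t , s∈L , t∈U , s₀≤s , t≤1 , t-s≤m/2) =
          closerTo-viaLower root {s} {t} {F̂ r} {r} s∈L t∈U t-s<d[r] F̂r-s<s-r
          where
          s≤1 = ≤-trans (<⇒≤ (lower<upper root s∈L t∈U)) t≤1
          t-s<d[r] : t - s < displacement r
          t-s<d[r] = <-≤-trans (≤-<-trans t-s≤m/2 (p*½<p 0<m)) (p⊓q≤q g (displacement r))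
          d[s]<g : displacement s < g
          d[s]<g = <-≤-trans (H[s]<K*[t-s] (≤-trans 0≤s₀ s₀≤s) t≤1 s∈L t∈U)
                             (≤-trans (p≤q*½⇒2*p≤q t-s≤m/2) (p⊓q≤p g (displacement r)))
          F̂r-s<s-r : F̂ r - s < s - r
          F̂r-s<s-r = begin-strict
            F̂ r - s                                          ≡⟨ telescope ⟩
            (F̂ r - F̂ s₀) + ((F̂ s₀ - F̂ s) + displacement s)
              <⟨ +-monoʳ-< (F̂ r - F̂ s₀) (+-mono-≤-< (F̂-drop≤ 0≤s₀ s₀≤s s≤1) d[s]<g) ⟩
            (F̂ r - F̂ s₀) + ((s - s₀) + g)                    ≡⟨ collapse ⟩
            s - r                                            ∎
            where
            open ≤-Reasoning
            telescope = solve 4 (λ s u v w → u :- s := (u :- v) :+ ((v :- w) :+ (w :- s))) refl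
                          s (F̂ r) (F̂ s₀) (F̂ s)
            collapse = solve 5 (λ r s s₀ u v → (u :- v) :+ ((s :- s₀) :+ ((s₀ :- r) :- (u :- v))) := s :- r)
                         refl r s s₀ (F̂ r) (F̂ s₀)

    closerTo-aboveRoot : ∀ {r} → 0ℚ ≤ r → r ≤ 1ℚ → displacement r < 0ℚ → root closerTo F̂ r than r
    closerTo-aboveRoot {r} 0≤r r≤1 d[r]<0 = fromAnchor (upper-rounded r (inj₂ (0≤r , r≤1 , d[r]<0)))
      where
      0<r-F̂r : 0ℚ < r - F̂ r
      0<r-F̂r = p<q⇒0<q-p (p-q<0⇒p<q {F̂ r} {r} d[r]<0)
      fromAnchor : (∃ λ t₀ → t₀ < r × Upper t₀) → root closerTo F̂ r than r
      fromAnchor (t₀ , t₀<r , t₀∈U) = fromBracket (bracket root a∈Lower t₀∈U (0<* 0<m 0<½))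
        where
        t₀≤1 = ≤-trans (<⇒≤ t₀<r) r≤1
        0≤t₀ = proj₁ (upper⇒negative t₀≤1 t₀∈U)
        g = (r - t₀) - (F̂ t₀ - F̂ r)
        0<g : 0ℚ < g
        0<g = p<q⇒0<q-p (≤-<-trans (p≤∣p∣ _) (F̂-contracting 0≤t₀ t₀<r r≤1))
        m = g ⊓ (r - F̂ r)
        0<m = 0<⊓ 0<g 0<r-F̂r
        fromBracket : Bracket root 0ℚ t₀ (m * ½) → root closerTo F̂ r than r
        fromBracket (s , t , s∈L , t∈U , 0≤s , t≤t₀ , t-s≤m/2) =
          closerTo-viaUpper root {s} {t} {F̂ r} {r} s∈L t∈U t-s<r-F̂r t-F̂r<r-t
          where
          0≤t = ≤-trans 0≤s (<⇒≤ (lower<upper root s∈L t∈U))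
          t-s<r-F̂r : t - s < r - F̂ r
          t-s<r-F̂r = <-≤-trans (≤-<-trans t-s≤m/2 (p*½<p 0<m)) (p⊓q≤q g (r - F̂ r))
          -d[t]<g : - displacement t < g
          -d[t]<g = <-≤-trans (-H[t]<K*[t-s] 0≤s (≤-trans t≤t₀ t₀≤1) s∈L t∈U)
                              (≤-trans (p≤q*½⇒2*p≤q t-s≤m/2) (p⊓q≤p g (r - F̂ r)))
          t-F̂r<r-t : t - F̂ r < r - t
          t-F̂r<r-t = begin-strict
            t - F̂ r                                            ≡⟨ telescope ⟩
            (F̂ t₀ - F̂ r) + ((F̂ t - F̂ t₀) + - displacement t)
              <⟨ +-monoʳ-< (F̂ t₀ - F̂ r) (+-mono-≤-< (F̂-drop≤ 0≤t t≤t₀ t₀≤1) -d[t]<g) ⟩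
            (F̂ t₀ - F̂ r) + ((t₀ - t) + g)                      ≡⟨ collapse ⟩
            r - t                                              ∎
            where
            open ≤-Reasoning
            telescope = solve 4 (λ t u v w → t :- u := (v :- u) :+ ((w :- v) :+ :- (w :- t))) refl
                          t (F̂ r) (F̂ t₀) (F̂ t)
            collapse = solve 5 (λ r t t₀ u v → (v :- u) :+ ((t₀ :- t) :+ ((r :- t₀) :- (v :- u))) := r :- t)
                         refl r t t₀ (F̂ r) (F̂ t₀)

    trace-fixedPoint : Σ ℝ λ α → Irrational α × IsTraceFunction F α
    trace-fixedPoint = root , root-irrational , λ r →
      subst (λ x → root closerTo x than val r) (F̂∘val r) (bySign r (<-cmp 0ℚ (displacement (val r))))
      where
      bySign : ∀ r → Tri (0ℚ < displacement (val r)) (0ℚ ≡ displacement (val r))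
                         (displacement (val r) < 0ℚ) →
               root closerTo F̂ (val r) than val r
      bySign r (tri< 0<d[r] _ _) = closerTo-belowRoot (0≤val r) (val≤1 r) 0<d[r]
      bySign r (tri≈ _ 0≡d[r] _) = ⊥-elim (displacement≢0 (0≤val r) (val≤1 r) (sym 0≡d[r]))
      bySign r (tri> _ _ d[r]<0) = closerTo-aboveRoot (0≤val r) (val≤1 r) d[r]<0

mainTheorem13 : (F : UnitQ → ℚ) → IsContractor F →
    Σ ℝ (λ α → Irrational α × IsTraceFunction F α)
mainTheorem13 F F-contractor = byEndpoints (<-cmp (displacement 0ℚ) 0ℚ) (<-cmp (displacement 1ℚ) 0ℚ)
  where
  open Contractor F F-contractor
  byEndpoints : Tri (displacement 0ℚ < 0ℚ) (displacement 0ℚ ≡ 0ℚ) (0ℚ < displacement 0ℚ) →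
                Tri (displacement 1ℚ < 0ℚ) (displacement 1ℚ ≡ 0ℚ) (0ℚ < displacement 1ℚ) →
                Σ ℝ (λ α → Irrational α × IsTraceFunction F α)
  byEndpoints (tri< d[0]<0 _ _) _                 = trace-belowDiagonal d[0]<0
  byEndpoints _                 (tri> _ _ 0<d[1]) = trace-aboveDiagonal 0<d[1]
  byEndpoints (tri> _ _ 0<d[0]) (tri< d[1]<0 _ _) = FixedPoint.trace-fixedPoint 0<d[0] d[1]<0
  byEndpoints (tri≈ _ d[0]≡0 _) _                 = ⊥-elim (displacement≢0 ≤-refl 0≤1 d[0]≡0)
  byEndpoints _                 (tri≈ _ d[1]≡0 _) = ⊥-elim (displacement≢0 0≤1 ≤-refl d[1]≡0)
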